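{- Let $M$ be a strong module of a CPT poset $\mathbf{P}=(X,P)$ and let $\{W_x\}_{x\in X}$ be a CPT representation of $\mathbf{P}$ in a tree $T$ in which some element $z\in M$ is represented by a trivial path $W_z=\{a\}$, $a$ a vertex of $T$. If $x\in X\setminus M$ is such that $a\in W_x$, then $W_m\subseteq W_x$ for every $m\in M$.
   Context: A CPT representation of a finite poset $\mathbf{P}=(X,P)$ is a tree $T$ with paths $W_x$ ($x\in X$, identified with vertex sets) such that $x<y$ iff $W_x\subsetneq W_y$; $\mathbf{P}$ is CPT if one exists. A trivial path is a single vertex. A module of $\mathbf{P}$ is a set $M\subseteq X$ such that each $y\in X\setminus M$ is comparable to all elements of $M$ or incomparable to all elements of $M$; $M$ is strong if for every module $M'$, $M\cap M'=\emptyset$, $M\subseteq M'$ or $M'\subseteq M$. -}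

module Defs where

open import Level using (0ℓ)
open import Data.Nat using (ℕ)
open import Data.Fin using (Fin)
open import Data.List using (List; []; _∷_)
open import Data.List.Membership.Propositional using (_∈_)
open import Data.List.Relation.Unary.Unique.Propositional using (Unique)
open import Data.Product using (_×_; Σ; ∃)
open import Data.Sum using (_⊎_)
open import Data.Empty using (⊥)
open import Data.Unit using (⊤)
open import Relation.Nullary using (¬_)
open import Relation.Unary using (Pred)
open import Relation.Binary.PropositionalEquality using (_≡_)
open import Relation.Binary.Structures using (IsStrictPartialOrder)
open import Function.Bundles using (_⇔_)

record FinPoset : Set₁ where
  field
    n       : ℕ
    _<_     : Fin n → Fin n → Set
    isSPO   : IsStrictPartialOrder _≡_ _<_

record Graph : Set₁ where
  field
    k     : ℕ
    Adj   : Fin k → Fin k → Set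
    sym   : ∀ {u v} → Adj u v → Adj v u
    irrefl : ∀ {u} → ¬ Adj u u

module _ (G : Graph) where
  open Graph G

  Chain : List (Fin k) → Set
  Chain []           = ⊤
  Chain (u ∷ [])     = ⊤
  Chain (u ∷ v ∷ vs) = Adj u v × Chain (v ∷ vs)

  last : Fin k → List (Fin k) → Fin k
  last u []       = u
  last u (v ∷ vs) = last v vs

  IsPath : List (Fin k) → Set
  IsPath []       = ⊥
  IsPath (u ∷ us) = Unique (u ∷ us) × Chain (u ∷ us)

  PathFromTo : Fin k → Fin k → List (Fin k) → Set
  PathFromTo u v []        = ⊥
  PathFromTo u v (w ∷ ws)  = IsPath (w ∷ ws) × (w ≡ u) × (last w ws ≡ v)

  Connected : Set
  Connected = ∀ u v → ∃ λ p → PathFromTo u v p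

  IsCycle : List (Fin k) → Set
  IsCycle []               = ⊥
  IsCycle (_ ∷ [])         = ⊥
  IsCycle (_ ∷ _ ∷ [])     = ⊥
  IsCycle (u ∷ v ∷ w ∷ ws) =
    IsPath (u ∷ v ∷ w ∷ ws) × Adj (last w ws) u

  Acyclic : Set
  Acyclic = ∀ c → ¬ IsCycle c

  -- a tree: non-empty, connected, acyclic
  IsTree : Set
  IsTree = Fin k × Connected × Acyclic

record Tree : Set₁ where
  field
    graph  : Graph
    isTree : IsTree graph
  open Graph graph public

module _ {A : Set} where
  _⊆ᵥ_ : List A → List A → Set
  xs ⊆ᵥ ys = ∀ {v} → v ∈ xs → v ∈ ys

  _⊊ᵥ_ : List A → List A → Set
  xs ⊊ᵥ ys = (xs ⊆ᵥ ys) × ¬ (ys ⊆ᵥ xs)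

record CPTRep (P : FinPoset) (T : Tree) : Set where
  open FinPoset P
  open Tree T
  field
    W      : Fin n → List (Fin k)
    isPath : ∀ x → IsPath graph (W x)
    rep    : ∀ x y → (x < y) ⇔ (W x ⊊ᵥ W y)

IsCPT : FinPoset → Set₁
IsCPT P = Σ Tree λ T → CPTRep P T

IsTrivialPathAt : {k : ℕ} → List (Fin k) → Fin k → Set
IsTrivialPathAt p a = ∀ v → (v ∈ p) ⇔ (v ≡ a)

module _ (P : FinPoset) where
  open FinPoset P

  Comparable : Fin n → Fin n → Set
  Comparable x y = (x < y) ⊎ (y < x)

  IsModule : Pred (Fin n) 0ℓ → Set
  IsModule M = ∀ y → ¬ M y →
      (∀ m → M m → Comparable y m)
    ⊎ (∀ m → M m → ¬ Comparable y m)

  IsStrongModule : Pred (Fin n) 0ℓ → Set₁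
  IsStrongModule M = IsModule M ×
    (∀ (M' : Pred (Fin n) 0ℓ) → IsModule M' →
        (∀ x → M x → ¬ M' x)
      ⊎ (∀ x → M x → M' x)
      ⊎ (∀ x → M' x → M x))

-- Since W_z = {a} ⊆ W_x, z is not above x. As M is a module, x is comparable to all of M or to
-- none of it. If to none, then z ≮ x forces W_x = W_z; so x and z are twins and {x, z} is a module,
-- which meets M without being contained in it, whence M ⊆ {x, z}, i.e. M = {z}. If to all, then
-- z < x, and every m ∈ M satisfies m < x or x < m. The latter is impossible: the elements lying
-- below every element of M above x and weakly above some element of M form a module containing
-- z and x but not m, so it overlaps M without nesting.
module Submission where

open import Defs
open import Level using (0ℓ)
open import Data.Fin using (Fin; _≟_)
open import Data.List using (List)
open import Data.List.Membership.Propositional using (_∈_)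
import Data.List.Relation.Binary.Subset.DecPropositional as DecSubset
open import Data.Product using (_×_; _,_; proj₁; proj₂; ∃-syntax)
open import Data.Sum using (_⊎_; inj₁; inj₂; [_,_]′)
open import Data.Empty using (⊥; ⊥-elim)
open import Function.Base using (_∘_)
open import Function.Bundles using (Equivalence)
open import Relation.Binary.Definitions using (Decidable)
open import Relation.Binary.PropositionalEquality using (_≡_; refl; sym; subst)
open import Relation.Binary.Structures using (IsStrictPartialOrder)
open import Relation.Nullary using (¬_; yes; no)
open import Relation.Nullary.Decidable
  using (_⊎-dec_; _×-dec_; ¬?; map′; decidable-stable; ¬¬-excluded-middle)
open import Relation.Unary using (Pred)

module _ {A : Set} {xs ys zs : List A} where

  ⊊-⊆-trans : xs ⊊ᵥ ys → ys ⊆ᵥ zs → xs ⊊ᵥ zs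
  ⊊-⊆-trans (xs⊆ys , ys⊈xs) ys⊆zs = ys⊆zs ∘ xs⊆ys , λ zs⊆xs → ys⊈xs (zs⊆xs ∘ ys⊆zs)

  ⊆-⊊-trans : xs ⊆ᵥ ys → ys ⊊ᵥ zs → xs ⊊ᵥ zs
  ⊆-⊊-trans xs⊆ys (ys⊆zs , zs⊈ys) = ys⊆zs ∘ xs⊆ys , λ zs⊆xs → zs⊈ys (xs⊆ys ∘ zs⊆xs)

trivialPath-⊆ : ∀ {k} {p q : List (Fin k)} {a} → IsTrivialPathAt p a → a ∈ q → p ⊆ᵥ q
trivialPath-⊆ {q = q} trivial a∈q v∈p =
  subst (_∈ q) (sym (Equivalence.to (trivial _) v∈p)) a∈q

module _ (P : FinPoset) (_<?_ : Decidable (FinPoset._<_ P)) where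
  open FinPoset P
  open IsStrictPartialOrder isSPO using (trans; irrefl)

  comparable? : Decidable (Comparable P)
  comparable? x y = x <? y ⊎-dec y <? x

  isModule-byRepresentative : (N : Pred (Fin n) 0ℓ) (z : Fin n) →
    (∀ w → ¬ N w → Comparable P w z → ∀ y → N y → Comparable P w y) →
    (∀ w → ¬ N w → ¬ Comparable P w z → ∀ y → N y → ¬ Comparable P w y) →
    IsModule P N
  isModule-byRepresentative N z all none w w∉N with comparable? w z
  ... | yes w~z = inj₁ (all w w∉N w~z)
  ... | no  w≁z = inj₂ (none w w∉N w≁z)

  strongModule-twin : ∀ {M x z} → IsStrongModule P M → M z → ¬ M x →
    (∀ {w} → Comparable P w x → Comparable P w z) →
    (∀ {w} → Comparable P w z → Comparable P w x) →
    ∀ m → M m → m ≡ z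
  strongModule-twin {M} {x} {z} (_ , strong) Mz ¬Mx x→z z→x m Mm
    with strong (λ y → y ≡ x ⊎ y ≡ z) isModule-pair
    where
    isModule-pair : IsModule P (λ y → y ≡ x ⊎ y ≡ z)
    isModule-pair = isModule-byRepresentative _ z
      (λ { _ _ w~z _ (inj₁ refl) → z→x w~z ; _ _ w~z _ (inj₂ refl) → w~z })
      (λ { _ _ w≁z _ (inj₁ refl) → w≁z ∘ x→z ; _ _ w≁z _ (inj₂ refl) → w≁z })
  ... | inj₁ disjoint        = ⊥-elim (disjoint z Mz (inj₂ refl))
  ... | inj₂ (inj₂ pair⊆M)   = ⊥-elim (¬Mx (pair⊆M x (inj₁ refl)))
  ... | inj₂ (inj₁ M⊆pair) with M⊆pair m Mm
  ...   | inj₁ refl = ⊥-elim (¬Mx Mm)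
  ...   | inj₂ m≡z  = m≡z

  module _ {M : Pred (Fin n) 0ℓ} (isModuleM : IsModule P M) {x z m : Fin n}
           (comparableM : ∀ u → M u → Comparable P x u)
           (Mz : M z) (Mm : M m) (z<x : z < x) (x<m : x < m) where

    BelowUpperAboveLower : Pred (Fin n) 0ℓ
    BelowUpperAboveLower y =
      (∀ u → M u → x < u → y < u) × ∃[ l ] (M l × (l ≡ y ⊎ l < y))

    private
      N = BelowUpperAboveLower

      N-lowerPart : ∀ w → M w → w < x → N w
      N-lowerPart w Mw w<x = (λ _ _ x<u → trans w<x x<u) , w , Mw , inj₁ refl

      <-≤-trans : ∀ {w l y} → w < l → l ≡ y ⊎ l < y → w < y
      <-≤-trans w<l (inj₁ refl) = w<l
      <-≤-trans w<l (inj₂ l<y)  = trans w<l l<y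

      ≤-<-trans : ∀ {l y w} → l ≡ y ⊎ l < y → y < w → l < w
      ≤-<-trans (inj₁ refl) y<w = y<w
      ≤-<-trans (inj₂ l<y)  y<w = trans l<y y<w

      comparable-all : ∀ w → ¬ N w → Comparable P w z → ∀ y → N y → Comparable P w y
      comparable-all w w∉N w~z y (upper , l , Ml , l≤y) =
        decidable-stable (comparable? w y) λ w≁y →
          ¬¬-excluded-middle λ { (yes Mw) → inM w≁y Mw (comparableM w Mw)
                               ; (no ¬Mw) → notInM w≁y (isModuleM w ¬Mw) }
        where
        inM : ¬ Comparable P w y → M w → Comparable P x w → ⊥
        inM w≁y Mw (inj₁ x<w) = w≁y (inj₂ (upper w Mw x<w))
        inM w≁y Mw (inj₂ w<x) = w∉N (N-lowerPart w Mw w<x)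

        notInM : ¬ Comparable P w y →
          (∀ u → M u → Comparable P w u) ⊎ (∀ u → M u → ¬ Comparable P w u) → ⊥
        notInM w≁y (inj₂ none) = none z Mz w~z
        notInM w≁y (inj₁ all) with all l Ml
        ... | inj₁ w<l = w≁y (inj₁ (<-≤-trans w<l l≤y))
        ... | inj₂ l<w = w∉N ((λ u Mu x<u → belowUpper u Mu x<u (all u Mu)) , l , Ml , inj₂ l<w)
          where
          belowUpper : ∀ u → M u → x < u → Comparable P w u → w < u
          belowUpper u Mu x<u (inj₁ w<u) = w<u
          belowUpper u Mu x<u (inj₂ u<w) = ⊥-elim (w≁y (inj₂ (trans (upper u Mu x<u) u<w)))

      incomparable-all : ∀ w → ¬ N w → ¬ Comparable P w z → ∀ y → N y → ¬ Comparable P w y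
      incomparable-all w w∉N w≁z y (upper , l , Ml , l≤y) w~y =
        ¬¬-excluded-middle λ { (yes Mw) → inM Mw (comparableM w Mw)
                             ; (no ¬Mw) → notInM (isModuleM w ¬Mw) w~y }
        where
        inM : M w → Comparable P x w → ⊥
        inM Mw (inj₁ x<w) = w≁z (inj₂ (trans z<x x<w))
        inM Mw (inj₂ w<x) = w∉N (N-lowerPart w Mw w<x)

        notInM : (∀ u → M u → Comparable P w u) ⊎ (∀ u → M u → ¬ Comparable P w u) →
          Comparable P w y → ⊥
        notInM (inj₁ all)  _          = w≁z (all z Mz)
        notInM (inj₂ none) (inj₁ w<y) = none m Mm (inj₁ (trans w<y (upper m Mm x<m)))
        notInM (inj₂ none) (inj₂ y<w) = none l Ml (inj₂ (≤-<-trans l≤y y<w))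

    isModule-belowUpperAboveLower : IsModule P BelowUpperAboveLower
    isModule-belowUpperAboveLower =
      isModule-byRepresentative BelowUpperAboveLower z comparable-all incomparable-all

  strongModule-¬between : ∀ {M x z m} → IsStrongModule P M → ¬ M x →
    (∀ u → M u → Comparable P x u) → M z → M m → z < x → ¬ x < m
  strongModule-¬between {M} {x} {z} {m} (isModuleM , strong) ¬Mx comparableM Mz Mm z<x x<m
    with strong _ (isModule-belowUpperAboveLower isModuleM comparableM Mz Mm z<x x<m)
  ... | inj₁ disjoint =
    disjoint z Mz ((λ _ _ x<u → trans z<x x<u) , z , Mz , inj₁ refl)
  ... | inj₂ (inj₁ M⊆N) = irrefl refl (proj₁ (M⊆N m Mm) m Mm x<m)
  ... | inj₂ (inj₂ N⊆M) = ¬Mx (N⊆M x ((λ _ _ x<u → x<u) , z , Mz , inj₂ z<x))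

module _ {P : FinPoset} {T : Tree} (R : CPTRep P T) where
  open FinPoset P
  open CPTRep R
  open DecSubset (_≟_ {Tree.k T}) using (_⊆?_)

  <⇒⊊ : ∀ {x y} → x < y → W x ⊊ᵥ W y
  <⇒⊊ {x} {y} = Equivalence.to (rep x y)

  ⊊⇒< : ∀ {x y} → W x ⊊ᵥ W y → x < y
  ⊊⇒< {x} {y} = Equivalence.from (rep x y)

  _<?_ : Decidable _<_
  x <? y = map′ ⊊⇒< <⇒⊊ (W x ⊆? W y ×-dec ¬? (W y ⊆? W x))

  ⊆⇒≯ : ∀ {x y} → W x ⊆ᵥ W y → ¬ y < x
  ⊆⇒≯ Wx⊆Wy y<x = proj₂ (<⇒⊊ y<x) Wx⊆Wy

  ⊆∧≮⇒⊇ : ∀ {x y} → W x ⊆ᵥ W y → ¬ x < y → W y ⊆ᵥ W x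
  ⊆∧≮⇒⊇ {x} {y} Wx⊆Wy x≮y =
    decidable-stable (W y ⊆? W x) λ Wy⊈Wx → x≮y (⊊⇒< (Wx⊆Wy , Wy⊈Wx))

  comparable-resp-⊆⊇ : ∀ {x y w} → W x ⊆ᵥ W y → W y ⊆ᵥ W x →
    Comparable P w x → Comparable P w y
  comparable-resp-⊆⊇ Wx⊆Wy _     (inj₁ w<x) = inj₁ (⊊⇒< (⊊-⊆-trans (<⇒⊊ w<x) Wx⊆Wy))
  comparable-resp-⊆⊇ _     Wy⊆Wx (inj₂ x<w) = inj₂ (⊊⇒< (⊆-⊊-trans Wy⊆Wx (<⇒⊊ x<w)))

lemma4 : (P : FinPoset) → IsCPT P →
    (M : Pred (Fin (FinPoset.n P)) 0ℓ) → IsStrongModule P M →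
    (T : Tree) → (R : CPTRep P T) →
    (z : Fin (FinPoset.n P)) → M z →
    (a : Fin (Tree.k T)) → IsTrivialPathAt (CPTRep.W R z) a →
    (x : Fin (FinPoset.n P)) → ¬ M x → a ∈ CPTRep.W R x →
    ∀ m → M m → CPTRep.W R m ⊆ᵥ CPTRep.W R x
lemma4 P _ M strongM T R z Mz a trivial x ¬Mx a∈Wx m Mm =
  [ comparableToM , incomparableToM ]′ (proj₁ strongM x ¬Mx)
  where
  open CPTRep R

  Wz⊆Wx : W z ⊆ᵥ W x
  Wz⊆Wx = trivialPath-⊆ trivial a∈Wx

  comparableToM : (∀ u → M u → Comparable P x u) → W m ⊆ᵥ W x
  comparableToM comparableM with comparableM m Mm | comparableM z Mz
  ... | inj₂ m<x | _        = proj₁ (<⇒⊊ R m<x)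
  ... | inj₁ x<m | inj₁ x<z = ⊥-elim (⊆⇒≯ R Wz⊆Wx x<z)
  ... | inj₁ x<m | inj₂ z<x =
    ⊥-elim (strongModule-¬between P (_<?_ R) strongM ¬Mx comparableM Mz Mm z<x x<m)

  incomparableToM : (∀ u → M u → ¬ Comparable P x u) → W m ⊆ᵥ W x
  incomparableToM incomparableM = subst (λ u → W u ⊆ᵥ W x) (sym m≡z) Wz⊆Wx
    where
    Wx⊆Wz : W x ⊆ᵥ W z
    Wx⊆Wz = ⊆∧≮⇒⊇ R Wz⊆Wx (incomparableM z Mz ∘ inj₂)

    m≡z : m ≡ z
    m≡z = strongModule-twin P (_<?_ R) strongM Mz ¬Mx
      (comparable-resp-⊆⊇ R Wx⊆Wz Wz⊆Wx) (comparable-resp-⊆⊇ R Wz⊆Wx Wx⊆Wz) m Mm
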